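{- Let $B$ be acyclic, let $v$ be a $c$-sortable element of $W$ and let $r\in S$. If $v\notin W_{\langle r\rangle}$, then $R_c^r(v)=\nu_c(\operatorname{cl}_c^r(v))$.
   Context: $I=\{1,\dots,n\}$; $B=[b_{ij}]$ skew-symmetrizable integer matrix ($\delta(i)b_{ij}=-\delta(j)b_{ji}$, $\delta>0$), acyclic (digraph $i\to j$ iff $b_{ij}<0$ has no directed cycle), indexed so that $b_{ij}>0$ implies $i<j$. Cartan companion $A$: $a_{ii}=2$, $a_{ij}=-|b_{ij}|$. $V$ has basis of simple roots $\alpha_i$, simple co-roots $\alpha_i^\vee=\delta(i)^{ -1}\alpha_i$; $V^*$ dual with pairing $\langle\cdot,\cdot\rangle$; fundamental weights $\rho_i$ dual to $\{\alpha_i^\vee\}$. Euler form on $V$: $E(\alpha_i^\vee,\alpha_j)=\min(b_{ij},0)$ for $i\ne j$, $E(\alpha_i^\vee,\alpha_i)=1$, extended bilinearly. $\nu_c:V\to V^*$ is the linear map with $\nu_c(\alpha_j)=-\sum_{i}E(\alpha_i^\vee,\alpha_j)\rho_i$. $W$ is the Coxeter group on $S=\{s_1,\dots,s_n\}$ (we write $\alpha_s$ for $\alpha_i$ when $s=s_i$) with $m(s_i,s_j)=2,3,4,6,\infty$ according as $a_{ij}a_{ji}=0,1,2,3,\ge4$, acting on $V$ by $s_i(\alpha_j)=\alpha_j-a_{ij}\alpha_i$ and $s_i(\alpha_j^\vee)=\alpha_j^\vee-a_{ji}\alpha_i^\vee$; the co-root of a real root $\beta=w\alpha_i$ is $\beta^\vee=w\alpha_i^\vee$.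 $c=s_1\cdots s_n$. $W_{\langle r\rangle}$ is the subgroup generated by $S\setminus\{r\}$. The $c$-sorting word of $w$ is the lexicographically leftmost subword of $c^\infty=s_1\cdots s_ns_1\cdots s_n\cdots$ that is a reduced word for $w$; $w$ is $c$-sortable if the letter sets used in successive copies of $s_1\cdots s_n$ are weakly decreasing. For $c$-sortable $v$ with $c$-sorting word $a_1\cdots a_k$ and $r\in S$: (i) take the leftmost occurrence of $r$ in $c^\infty$ not used by the subword, let $a_1\cdots a_j$ be the letters of the subword before it, and set $C_c^r(v)=a_1\cdots a_j\alpha_r$; the roots $C_c^r(v)$, $r\in S$, are distinct and their co-roots form a basis of $V$; $R_c^r(v)\in V^*$ is the element of the dual basis to $\{(C_c^q(v))^\vee:q\in S\}$ dual to $(C_c^r(v))^\vee$. (ii) $\operatorname{cl}_c^r(v)=-\alpha_r$ if $r$ does not occur in $a_1\cdots a_k$; otherwise, with $i$ the largest index with $a_i=r$, $\operatorname{cl}_c^r(v)=a_1\cdots a_{i-1}\alpha_r$. -}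

module Defs where

open import Data.Bool using (Bool; true; false; if_then_else_; _∧_; _∨_; T)
open import Data.Nat as ℕ using (ℕ; zero; suc; NonZero; _<ᵇ_; _≡ᵇ_)
open import Data.Integer as ℤ using (ℤ; +_; -[1+_])
open import Data.Rational as ℚ using (ℚ; 0ℚ; 1ℚ)
open import Data.Fin as Fin using (Fin; toℕ)
open import Data.List using (List; []; _∷_; _++_; map; concat; replicate; length; filter; foldr; allFin)
open import Data.Bool.ListAction using (any)
open import Data.List.Membership.Propositional using (_∈_; _∉_)
open import Data.List.Relation.Unary.Linked using (Linked)
open import Data.Maybe using (Maybe; just; nothing)
open import Data.Product using (_×_; _,_; proj₂; ∃)
open import Relation.Nullary using (¬_; does)
open import Relation.Binary.PropositionalEquality using (_≡_; _≢_)

record SkewData (n : ℕ) : Set where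
  field
    B    : Fin n → Fin n → ℤ
    δ    : Fin n → ℕ
    δ-nz : ∀ i → NonZero (δ i)
open SkewData public

module _ {n : ℕ} (D : SkewData n) where

  SkewSymmetrizable : Set
  SkewSymmetrizable = ∀ i j → (+ δ D i) ℤ.* B D i j ≡ ℤ.- ((+ δ D j) ℤ.* B D j i)

  Edge : Fin n → Fin n → Set
  Edge i j = B D i j ℤ.< + 0

  data Path⁺ : Fin n → Fin n → Set where
    [_]  : ∀ {i j} → Edge i j → Path⁺ i j
    _∷ₚ_ : ∀ {i j k} → Edge i j → Path⁺ j k → Path⁺ i k

  Acyclic : Set
  Acyclic = ∀ i → ¬ Path⁺ i i

  IndexedCompatibly : Set
  IndexedCompatibly = ∀ i j → + 0 ℤ.< B D i j → i Fin.< j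

_==_ : ∀ {n} → Fin n → Fin n → Bool
i == j = does (i Fin.≟ j)

cartan : ∀ {n} → SkewData n → Fin n → Fin n → ℤ
cartan D i j = if i == j then + 2 else ℤ.- (+ ℤ.∣ B D i j ∣)

data Exp : Set where
  fin : ℕ → Exp
  ∞   : Exp

mOfProduct : ℕ → Exp
mOfProduct 0 = fin 2
mOfProduct 1 = fin 3
mOfProduct 2 = fin 4
mOfProduct 3 = fin 6
mOfProduct _ = ∞

coxeterM : ∀ {n} → SkewData n → Fin n → Fin n → Exp
coxeterM D i j = mOfProduct ℤ.∣ cartan D i j ℤ.* cartan D j i ∣

-- The Coxeter group W: words in S = Fin n modulo the Coxeter relations
-- s_i s_i = e and (s_i s_j)^m(i,j) = e (i ≠ j, m finite).

Word : ℕ → Set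
Word n = List (Fin n)

data CoxRel₀ {n : ℕ} (D : SkewData n) : Word n → Word n → Set where
  square : ∀ i → CoxRel₀ D (i ∷ i ∷ []) []
  braid  : ∀ i j m → i ≢ j → coxeterM D i j ≡ fin m →
           CoxRel₀ D (concat (replicate m (i ∷ j ∷ []))) []

data EqW {n : ℕ} (D : SkewData n) : Word n → Word n → Set where
  rel    : ∀ u x y w → CoxRel₀ D x y → EqW D (u ++ x ++ w) (u ++ y ++ w)
  reflW  : ∀ u → EqW D u u
  symW   : ∀ {u w} → EqW D u w → EqW D w u
  transW : ∀ {u w z} → EqW D u w → EqW D w z → EqW D u z

Reduced : ∀ {n} → SkewData n → Word n → Set
Reduced D w = ∀ u → EqW D u w → length w ℕ.≤ length u

-- v lies in the standard parabolic subgroup W_⟨r⟩ generated by S ∖ {r}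
InParabolic : ∀ {n} → SkewData n → Fin n → Word n → Set
InParabolic D r v = ∃ λ u → r ∉ u × EqW D u v

-- Positions in c^∞ = s_1⋯s_n s_1⋯s_n ⋯ : (copy k, letter i).

Pos : ℕ → Set
Pos n = ℕ × Fin n

_<ᵖ_ : ∀ {n} → Pos n → Pos n → Bool
(k , i) <ᵖ (k' , i') = (k <ᵇ k') ∨ ((k ≡ᵇ k') ∧ (toℕ i <ᵇ toℕ i'))

_=ᵖ_ : ∀ {n} → Pos n → Pos n → Bool
(k , i) =ᵖ (k' , i') = (k ≡ᵇ k') ∧ (i == i')

_<P_ : ∀ {n} → Pos n → Pos n → Set
p <P q = T (p <ᵖ q)

IsSubword : ∀ {n} → List (Pos n) → Set
IsSubword ps = Linked _<P_ ps

letters : ∀ {n} → List (Pos n) → Word n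
letters = map proj₂

data _≤Lex_ {n : ℕ} : List (Pos n) → List (Pos n) → Set where
  nil   : ∀ {ys} → [] ≤Lex ys
  here  : ∀ {x y xs ys} → x <P y → (x ∷ xs) ≤Lex (y ∷ ys)
  there : ∀ {x xs ys} → xs ≤Lex ys → (x ∷ xs) ≤Lex (x ∷ ys)

IsCSortingWord : ∀ {n} → SkewData n → Word n → List (Pos n) → Set
IsCSortingWord D v ps =
  IsSubword ps × Reduced D (letters ps) × EqW D (letters ps) v ×
  (∀ qs → IsSubword qs → Reduced D (letters qs) → EqW D (letters qs) v → ps ≤Lex qs)

-- letter sets of successive copies of c are weakly decreasing
CSortableWord : ∀ {n} → List (Pos n) → Set
CSortableWord ps = ∀ k i → (suc k , i) ∈ ps → (k , i) ∈ ps

-- The representation V (coordinates in the basis of simple roots).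

V : ℕ → Set
V n = Fin n → ℚ

-- V^* in coordinates w.r.t. the fundamental weights ρ_i
V* : ℕ → Set
V* n = Fin n → ℚ

sumℚ : ∀ {n} → (Fin n → ℚ) → ℚ
sumℚ {n} f = foldr ℚ._+_ 0ℚ (map f (allFin n))

ℤ→ℚ : ℤ → ℚ
ℤ→ℚ z = z ℚ./ 1

α : ∀ {n} → Fin n → V n
α i k = if k == i then 1ℚ else 0ℚ

αᵛ : ∀ {n} → SkewData n → Fin n → V n
αᵛ D i k = if k == i then ((+ 1) ℚ./ δ D i) {{δ-nz D i}} else 0ℚ

reflect : ∀ {n} → SkewData n → Fin n → V n → V n
reflect D i x k =
  if k == i then x k ℚ.- sumℚ (λ j → ℤ→ℚ (cartan D i j) ℚ.* x j) else x k

act : ∀ {n} → SkewData n → Word n → V n → V n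
act D []      x = x
act D (a ∷ w) x = reflect D a (act D w x)

-- ⟨φ, x⟩, φ = Σ φ_i ρ_i, x = Σ x_j α_j = Σ x_j δ(j) α_j^∨
pairing : ∀ {n} → SkewData n → V* n → V n → ℚ
pairing D φ x = sumℚ (λ j → φ j ℚ.* (ℤ→ℚ (+ δ D j) ℚ.* x j))

-- Euler form E(α_i^∨, α_j)
euler : ∀ {n} → SkewData n → Fin n → Fin n → ℤ
euler D i j = if i == j then + 1 else ℤ._⊓_ (B D i j) (+ 0)

νc : ∀ {n} → SkewData n → V n → V* n
νc D x i = ℚ.- sumℚ (λ j → ℤ→ℚ (euler D i j) ℚ.* x j)

prefixBeforeLast : ∀ {n} → Fin n → Word n → Maybe (Word n)
prefixBeforeLast r [] = nothing
prefixBeforeLast r (a ∷ w) with prefixBeforeLast r w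
... | just p  = just (a ∷ p)
... | nothing = if a == r then just [] else nothing

cl : ∀ {n} → SkewData n → Fin n → List (Pos n) → V n
cl D r ps with prefixBeforeLast r (letters ps)
... | nothing = λ k → ℚ.- α r k
... | just p  = act D p (α r)

memberᵖ : ∀ {n} → Pos n → List (Pos n) → Bool
memberᵖ p ps = any (p =ᵖ_) ps

-- first copy index k ≥ k₀ such that (k , q) is not used (fuel-bounded;
-- with fuel = length ps starting at 0 this is the true leftmost
-- unused occurrence, since ps has only length ps entries)
firstFreeFrom : ∀ {n} → ℕ → ℕ → Fin n → List (Pos n) → ℕ
firstFreeFrom zero    k q ps = k
firstFreeFrom (suc f) k q ps =
  if memberᵖ (k , q) ps then firstFreeFrom f (suc k) q ps else k

leftmostFree : ∀ {n} → Fin n → List (Pos n) → Pos n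
leftmostFree q ps = (firstFreeFrom (length ps) 0 q ps , q)

prefixBefore : ∀ {n} → Fin n → List (Pos n) → Word n
prefixBefore q ps = letters (filter (λ p → T? (p <ᵖ leftmostFree q ps)) ps)
  where
  open import Data.Bool.Properties using (T?)

Cc : ∀ {n} → SkewData n → Fin n → List (Pos n) → V n
Cc D q ps = act D (prefixBefore q ps) (α q)

Ccᵛ : ∀ {n} → SkewData n → Fin n → List (Pos n) → V n
Ccᵛ D q ps = act D (prefixBefore q ps) (αᵛ D q)

-- R_c^r(v) is the element of V^* dual to (C_c^r(v))^∨ in the dual
-- basis of {(C_c^q(v))^∨}; φ equals it iff ⟨φ,(C_c^q)^∨⟩ = [q = r] ∀q.
IsRc : ∀ {n} → SkewData n → Fin n → List (Pos n) → V* n → Set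
IsRc {n} D r ps φ = ∀ (q : Fin n) → pairing D φ (Ccᵛ D q ps) ≡ (if q == r then 1ℚ else 0ℚ)

module Submission where

-- Since ⟨ν_c(x), y⟩ = −E(y, x) for the Euler form E and (C_c^q)^∨ =
-- δ(q)⁻¹ C_c^q, the claim amounts to E(C_c^q(v), cl_c^r(v)) = −δ(q) if
-- q = r and 0 otherwise.  We prove this for every letter r of the
-- c-sorting word by induction along the word.  Appending a position
-- (t , i) to a sorted c-sortable subword with letters w changes only the
-- roots C_c^q whose leftmost unused position moves past (t , i), each by
-- the multiple −a_iq of β = w α_i; the values of E involving β come from
-- two facts: the symmetrisation of E is the W-invariant form of the
-- Cartan companion (by skew-symmetrizability), and E is upper triangular
-- on simple roots (by the compatible indexing).  The induction also
-- carries E(C_a, C_b) = 0 whenever the position of a precedes that of b.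
-- The letter r occurs in the word because v ∉ W_⟨r⟩.

open import Defs
open import Algebra.Bundles using (Ring)
open import Data.Bool using (true; false; T; if_then_else_)
import Data.Bool.Properties as BoolP
open import Data.Empty using (⊥-elim)
open import Data.Fin as Fin using (Fin; toℕ)
import Data.Fin.Properties as FinP
open import Data.Integer as ℤ using (ℤ; +_; -[1+_])
import Data.Integer.Properties as ℤP
import Data.Integer.Solver as ℤSolver
open import Data.List using (List; []; _∷_; _++_; foldr; filter; length; tabulate)
open import Data.List.Reverse using (Reverse; []; _∶_∶ʳ_; reverseView)
import Data.List.Properties as ListP
open import Data.Maybe using (Maybe; just; nothing)
open import Data.Nat as ℕ using (ℕ; zero; suc; NonZero; z≤n; s≤s)
import Data.Nat.Properties as ℕP
import Data.Nat.Solver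
open import Data.Product using (_×_; _,_; proj₁; proj₂; ∃)
open import Data.Rational as ℚ using (ℚ; 0ℚ; 1ℚ)
import Data.Rational.Properties as ℚP
import Data.Rational.Solver as ℚSolver
import Data.Rational.Unnormalised as ℚᵘ
import Data.Rational.Unnormalised.Properties as ℚᵘP
open import Data.Sum using (_⊎_; inj₁; inj₂)
open import Function using (_∘_; id)
open import Relation.Binary.PropositionalEquality
open import Relation.Nullary using (¬_; yes; no)
open import Relation.Nullary.Decidable using (dec-true; dec-false)


-- ℤ→ℚ is a ring homomorphism; we check it after passing to
-- unnormalised rationals, where the operations are plain formulas.
module IntegerEmbedding where

  open import Data.Rational using (_+_; _*_)

  private
    asFraction : ∀ z → ℚ.toℚᵘ (ℤ→ℚ z) ℚᵘ.≃ ℚᵘ.mkℚᵘ z 0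
    asFraction z = ℚP.toℚᵘ-fromℚᵘ (ℚᵘ.mkℚᵘ z 0)

  ℤ→ℚ-+ : ∀ x y → ℤ→ℚ (x ℤ.+ y) ≡ ℤ→ℚ x + ℤ→ℚ y
  ℤ→ℚ-+ x y = ℚP.toℚᵘ-injective (begin
      ℚ.toℚᵘ (ℤ→ℚ (x ℤ.+ y))                 ≈⟨ asFraction (x ℤ.+ y) ⟩
      ℚᵘ.mkℚᵘ (x ℤ.+ y) 0                     ≈⟨ ℚᵘ.*≡* (solve 2 (λ x y → (x :+ y) :* con (+ 1) := (x :* con (+ 1) :+ y :* con (+ 1)) :* con (+ 1)) refl x y) ⟩
      ℚᵘ.mkℚᵘ x 0 ℚᵘ.+ ℚᵘ.mkℚᵘ y 0             ≈⟨ ℚᵘP.+-cong (asFraction x) (asFraction y) ⟨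
      ℚ.toℚᵘ (ℤ→ℚ x) ℚᵘ.+ ℚ.toℚᵘ (ℤ→ℚ y)      ≈⟨ ℚP.toℚᵘ-homo-+ (ℤ→ℚ x) (ℤ→ℚ y) ⟨
      ℚ.toℚᵘ (ℤ→ℚ x + ℤ→ℚ y)                 ∎)
    where
    open ℤSolver.+-*-Solver
    open import Relation.Binary.Reasoning.Setoid ℚᵘP.≃-setoid

  ℤ→ℚ-* : ∀ x y → ℤ→ℚ (x ℤ.* y) ≡ ℤ→ℚ x * ℤ→ℚ y
  ℤ→ℚ-* x y = ℚP.toℚᵘ-injective (begin
      ℚ.toℚᵘ (ℤ→ℚ (x ℤ.* y))                 ≈⟨ asFraction (x ℤ.* y) ⟩
      ℚᵘ.mkℚᵘ (x ℤ.* y) 0                     ≈⟨ ℚᵘP.≃-refl ⟩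
      ℚᵘ.mkℚᵘ x 0 ℚᵘ.* ℚᵘ.mkℚᵘ y 0             ≈⟨ ℚᵘP.*-cong (asFraction x) (asFraction y) ⟨
      ℚ.toℚᵘ (ℤ→ℚ x) ℚᵘ.* ℚ.toℚᵘ (ℤ→ℚ y)      ≈⟨ ℚP.toℚᵘ-homo-* (ℤ→ℚ x) (ℤ→ℚ y) ⟨
      ℚ.toℚᵘ (ℤ→ℚ x * ℤ→ℚ y)                 ∎)
    where open import Relation.Binary.Reasoning.Setoid ℚᵘP.≃-setoid

  reciprocal-cancel : ∀ (d : ℕ) .{{_ : NonZero d}} → ((+ 1) ℚ./ d) * ℤ→ℚ (+ d) ≡ 1ℚ
  reciprocal-cancel (suc d) = ℚP.toℚᵘ-injective (begin
      ℚ.toℚᵘ (((+ 1) ℚ./ suc d) * ℤ→ℚ (+ suc d))   ≈⟨ ℚP.toℚᵘ-homo-* ((+ 1) ℚ./ suc d) (ℤ→ℚ (+ suc d)) ⟩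
      ℚ.toℚᵘ ((+ 1) ℚ./ suc d) ℚᵘ.* ℚ.toℚᵘ (ℤ→ℚ (+ suc d))
                                                  ≈⟨ ℚᵘP.*-cong (ℚP.toℚᵘ-fromℚᵘ (ℚᵘ.mkℚᵘ (+ 1) d)) (asFraction (+ suc d)) ⟩
      ℚᵘ.mkℚᵘ (+ 1) d ℚᵘ.* ℚᵘ.mkℚᵘ (+ suc d) 0      ≈⟨ ℚᵘ.*≡* (cong (λ m → + suc m) (ℕSolver.solve 1 (λ d → (d :+ con 0 :* (con 1 :+ d)) :* con 1 := d :* con 1 :+ con 0 :* (con 1 :+ d :* con 1)) refl d)) ⟩
      ℚᵘ.1ℚᵘ                                      ∎)
    where
    open import Relation.Binary.Reasoning.Setoid ℚᵘP.≃-setoid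
    module ℕSolver = Data.Nat.Solver.+-*-Solver
    open ℕSolver using (_:+_; _:*_; con; _:=_)

open IntegerEmbedding

module OppositeSigns where

  open import Data.Integer using (_+_; _*_; -_; _⊓_; _≤_; _<_)
  open ℤP.≤-Reasoning

  private
    flip-eq : ∀ a b {x y : ℤ} → a * x ≡ - (b * y) → b * y ≡ - (a * x)
    flip-eq a b {x} {y} eq = trans (sym (ℤP.neg-involutive (b * y))) (cong -_ (sym eq))

    neg-scaled-zero : ∀ a → - (a * + 0) ≡ + 0
    neg-scaled-zero a = cong -_ (ℤP.*-zeroʳ a)

  nonneg⇒nonpos : ∀ δ δ' .{{_ : NonZero δ}} .{{_ : NonZero δ'}} {x y : ℤ} →
                  + δ * x ≡ - (+ δ' * y) → + 0 ≤ x → y ≤ + 0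
  nonneg⇒nonpos (suc δ) (suc δ') {x} {y} eq 0≤x = ℤP.*-cancelˡ-≤-pos y (+ 0) (+ suc δ') (begin
    + suc δ' * y        ≡⟨ flip-eq (+ suc δ) (+ suc δ') eq ⟩
    - (+ suc δ * x)     ≤⟨ ℤP.neg-mono-≤ (ℤP.*-monoˡ-≤-nonNeg (+ suc δ) 0≤x) ⟩
    - (+ suc δ * + 0)   ≡⟨ neg-scaled-zero (+ suc δ) ⟩
    + 0                 ≡⟨ ℤP.*-zeroʳ (+ suc δ') ⟨
    + suc δ' * + 0      ∎)

  neg⇒pos : ∀ δ δ' .{{_ : NonZero δ}} .{{_ : NonZero δ'}} {x y : ℤ} →
            + δ * x ≡ - (+ δ' * y) → x < + 0 → + 0 < y
  neg⇒pos (suc δ) (suc δ') {x} {y} eq x<0 = ℤP.*-cancelˡ-<-nonNeg (+ suc δ') (begin-strict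
    + suc δ' * + 0      ≡⟨ ℤP.*-zeroʳ (+ suc δ') ⟩
    + 0                 ≡⟨ neg-scaled-zero (+ suc δ) ⟨
    - (+ suc δ * + 0)   <⟨ ℤP.neg-mono-< (ℤP.*-monoˡ-<-pos (+ suc δ) x<0) ⟩
    - (+ suc δ * x)     ≡⟨ flip-eq (+ suc δ) (+ suc δ') eq ⟨
    + suc δ' * y        ∎)

  -- Consequently the negative parts of b and b' add up to −δ|b|: this is
  -- the Euler-form identity behind the invariance of its symmetrisation.
  negative-parts : ∀ δ δ' .{{_ : NonZero δ}} .{{_ : NonZero δ'}} (b b' : ℤ) →
                   + δ * b ≡ - (+ δ' * b') →
                   + δ * (b ⊓ + 0) + + δ' * (b' ⊓ + 0) ≡ + δ * - (+ ℤ.∣ b ∣)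
  negative-parts δ δ' (+ m) b' eq = begin-equality
    + δ * (+ m ⊓ + 0) + + δ' * (b' ⊓ + 0)
      ≡⟨ cong₂ (λ p q → + δ * p + + δ' * q) (ℤP.i≥j⇒i⊓j≡j (ℤ.+≤+ z≤n)) (ℤP.i≤j⇒i⊓j≡i (nonneg⇒nonpos δ δ' eq (ℤ.+≤+ z≤n))) ⟩
    + δ * + 0 + + δ' * b'    ≡⟨ cong (_+ (+ δ' * b')) (ℤP.*-zeroʳ (+ δ)) ⟩
    + 0 + + δ' * b'          ≡⟨ ℤP.+-identityˡ (+ δ' * b') ⟩
    + δ' * b'                ≡⟨ flip-eq (+ δ) (+ δ') eq ⟩
    - (+ δ * + m)            ≡⟨ ℤP.neg-distribʳ-* (+ δ) (+ m) ⟩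
    + δ * - (+ m)            ∎
  negative-parts δ δ' -[1+ m ] b' eq = begin-equality
    + δ * -[1+ m ] + + δ' * (b' ⊓ + 0)
      ≡⟨ cong (λ q → + δ * -[1+ m ] + + δ' * q) (ℤP.i≥j⇒i⊓j≡j (ℤP.<⇒≤ (neg⇒pos δ δ' eq ℤ.-<+))) ⟩
    + δ * -[1+ m ] + + δ' * + 0  ≡⟨ cong (_+_ (+ δ * -[1+ m ])) (ℤP.*-zeroʳ (+ δ')) ⟩
    + δ * -[1+ m ] + + 0         ≡⟨ ℤP.+-identityʳ (+ δ * -[1+ m ]) ⟩
    + δ * -[1+ m ]               ∎

open OppositeSigns

module FiniteSums where

  open import Data.Rational using (_+_; _*_; -_)

  open import Algebra.Properties.Semiring.Sum (Ring.semiring ℚP.+-*-ring) public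
    using (sum; sum-cong-≗; sum-replicate-zero; ∑-distrib-+; *-distribˡ-sum)

  sumℚ≡sum : ∀ {m} (f : Fin m → ℚ) → sumℚ f ≡ sum f
  sumℚ≡sum f = trans (cong (foldr _+_ 0ℚ) (ListP.map-tabulate id f)) (foldr-tabulate f)
    where
    foldr-tabulate : ∀ {k} (g : Fin k → ℚ) → foldr _+_ 0ℚ (tabulate g) ≡ sum g
    foldr-tabulate {zero}  g = refl
    foldr-tabulate {suc k} g = cong (_+_ (g Fin.zero)) (foldr-tabulate (g ∘ Fin.suc))

  sum-*ˡ : ∀ {m} (c : ℚ) (f : Fin m → ℚ) → sum (λ i → c * f i) ≡ c * sum f
  sum-*ˡ c f = sym (*-distribˡ-sum c f)

  sum-neg : ∀ {m} (f : Fin m → ℚ) → sum (λ i → - f i) ≡ - sum f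
  sum-neg {zero}  f = refl
  sum-neg {suc m} f = trans (cong (_+_ (- f Fin.zero)) (sum-neg (f ∘ Fin.suc)))
                            (sym (ℚP.neg-distrib-+ (f Fin.zero) (sum (f ∘ Fin.suc))))

  sum-α : ∀ {m} (i : Fin m) (g : Fin m → ℚ) → sum (λ j → g j * α i j) ≡ g i
  sum-α {suc m} Fin.zero g = begin
    g Fin.zero * 1ℚ + sum {m} (λ j → g (Fin.suc j) * 0ℚ) ≡⟨ cong₂ _+_ (ℚP.*-identityʳ (g Fin.zero)) (sum-cong-≗ (λ j → ℚP.*-zeroʳ (g (Fin.suc j)))) ⟩
    g Fin.zero + sum {m} (λ _ → 0ℚ)                  ≡⟨ cong (_+_ (g Fin.zero)) (sum-replicate-zero m) ⟩
    g Fin.zero + 0ℚ                                  ≡⟨ ℚP.+-identityʳ _ ⟩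
    g Fin.zero                                       ∎
    where open ≡-Reasoning
  sum-α {suc m} (Fin.suc i) g =
    trans (cong₂ _+_ (ℚP.*-zeroʳ (g Fin.zero)) (sum-α i (g ∘ Fin.suc))) (ℚP.+-identityˡ _)

open FiniteSums

module Geometry {n : ℕ} (D : SkewData n) where

  open import Data.Rational using (_+_; _*_; -_)
  open ℚSolver.+-*-Solver using (solve; _:+_; _:*_; :-_; con; _:=_)

  d : Fin n → ℚ
  d i = ℤ→ℚ (+ δ D i)

  e : Fin n → Fin n → ℚ
  e i j = ℤ→ℚ (euler D i j)

  A : Fin n → Fin n → ℚ
  A i j = ℤ→ℚ (cartan D i j)

  infixl 6 _⊕_
  infixl 7 _⊙_

  _⊕_ : V n → V n → V n
  (x ⊕ y) k = x k + y k

  _⊙_ : ℚ → V n → V n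
  (c ⊙ x) k = c * x k

  dot : (Fin n → ℚ) → (Fin n → ℚ) → ℚ
  dot w x = sum (λ k → w k * x k)

  dot-cong : ∀ {w w' x x'} → w ≗ w' → x ≗ x' → dot w x ≡ dot w' x'
  dot-cong ew ex = sum-cong-≗ (λ k → cong₂ _*_ (ew k) (ex k))

  dot-comm : ∀ w x → dot w x ≡ dot x w
  dot-comm w x = sum-cong-≗ (λ k → ℚP.*-comm (w k) (x k))

  dot-linʳ : ∀ w x c y → dot w (x ⊕ c ⊙ y) ≡ dot w x + c * dot w y
  dot-linʳ w x c y = begin
    sum (λ k → w k * (x k + c * y k))             ≡⟨ sum-cong-≗ (λ k → distrib (w k) (x k) (y k)) ⟩
    sum (λ k → w k * x k + c * (w k * y k))       ≡⟨ ∑-distrib-+ (λ k → w k * x k) (λ k → c * (w k * y k)) ⟩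
    dot w x + sum (λ k → c * (w k * y k))         ≡⟨ cong (_+_ (dot w x)) (sum-*ˡ c (λ k → w k * y k)) ⟩
    dot w x + c * dot w y                         ∎
    where
    open ≡-Reasoning
    distrib : ∀ p q r → p * (q + c * r) ≡ p * q + c * (p * r)
    distrib = solve 4 (λ c p q r → p :* (q :+ c :* r) := p :* q :+ c :* (p :* r)) refl c

  dot-linˡ : ∀ x c y w → dot (x ⊕ c ⊙ y) w ≡ dot x w + c * dot y w
  dot-linˡ x c y w = trans (dot-comm (x ⊕ c ⊙ y) w)
    (trans (dot-linʳ w x c y) (cong₂ (λ p q → p + c * q) (dot-comm w x) (dot-comm w y)))

  dot-scaleˡ : ∀ c x w → dot (c ⊙ x) w ≡ c * dot x w
  dot-scaleˡ c x w = trans (sum-cong-≗ (λ k → ℚP.*-assoc c (x k) (w k))) (sum-*ˡ c (λ k → x k * w k))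

  dot-α : ∀ w i → dot w (α i) ≡ w i
  dot-α w i = sum-α i w

  cartanRow : Fin n → V n → ℚ
  cartanRow i = dot (A i)

  reflect-eq : ∀ i x → reflect D i x ≗ x ⊕ (- cartanRow i x) ⊙ α i
  reflect-eq i x k with k == i
  ... | true  = cong (_+_ (x k)) (trans (cong -_ (sumℚ≡sum (λ j → A i j * x j))) (sym (ℚP.*-identityʳ (- cartanRow i x))))
  ... | false = sym (trans (cong (_+_ (x k)) (ℚP.*-zeroʳ (- cartanRow i x))) (ℚP.+-identityʳ (x k)))

  reflect-cong : ∀ i {x y} → x ≗ y → reflect D i x ≗ reflect D i y
  reflect-cong i {x} {y} eq k = begin
    reflect D i x k                              ≡⟨ reflect-eq i x k ⟩
    x k + (- cartanRow i x) * α i k              ≡⟨ cong₂ (λ p q → p + (- q) * α i k) (eq k) (dot-cong {A i} (λ _ → refl) eq) ⟩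
    y k + (- cartanRow i y) * α i k              ≡⟨ reflect-eq i y k ⟨
    reflect D i y k                              ∎
    where open ≡-Reasoning

  reflect-lin : ∀ i x c y → reflect D i (x ⊕ c ⊙ y) ≗ reflect D i x ⊕ c ⊙ reflect D i y
  reflect-lin i x c y k = begin
    reflect D i (x ⊕ c ⊙ y) k                                          ≡⟨ reflect-eq i (x ⊕ c ⊙ y) k ⟩
    x k + c * y k + (- cartanRow i (x ⊕ c ⊙ y)) * α i k                ≡⟨ cong (λ t → x k + c * y k + (- t) * α i k) (dot-linʳ (A i) x c y) ⟩
    x k + c * y k + (- (cartanRow i x + c * cartanRow i y)) * α i k    ≡⟨ regroup (x k) c (y k) (cartanRow i x) (cartanRow i y) (α i k) ⟩
    x k + (- cartanRow i x) * α i k + c * (y k + (- cartanRow i y) * α i k)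
                                                                       ≡⟨ cong₂ (λ p q → p + c * q) (reflect-eq i x k) (reflect-eq i y k) ⟨
    reflect D i x k + c * reflect D i y k                              ∎
    where
    open ≡-Reasoning
    regroup : ∀ xk c yk px py ak →
      xk + c * yk + (- (px + c * py)) * ak ≡ xk + (- px) * ak + c * (yk + (- py) * ak)
    regroup = solve 6 (λ xk c yk px py ak →
      xk :+ c :* yk :+ (:- (px :+ c :* py)) :* ak := xk :+ (:- px) :* ak :+ c :* (yk :+ (:- py) :* ak)) refl

  reflect-scale : ∀ i c x → reflect D i (c ⊙ x) ≗ c ⊙ reflect D i x
  reflect-scale i c x k = begin
    reflect D i (c ⊙ x) k                          ≡⟨ reflect-eq i (c ⊙ x) k ⟩
    c * x k + (- dot (A i) (c ⊙ x)) * α i k        ≡⟨ cong (λ t → c * x k + (- t) * α i k) scaled ⟩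
    c * x k + (- (c * cartanRow i x)) * α i k      ≡⟨ regroup c (x k) (cartanRow i x) (α i k) ⟩
    c * (x k + (- cartanRow i x) * α i k)          ≡⟨ cong (c *_) (reflect-eq i x k) ⟨
    c * reflect D i x k                            ∎
    where
    open ≡-Reasoning
    scaled : dot (A i) (c ⊙ x) ≡ c * cartanRow i x
    scaled = trans (dot-comm (A i) (c ⊙ x)) (trans (dot-scaleˡ c x (A i)) (cong (c *_) (dot-comm x (A i))))
    regroup : ∀ c xk p ak → c * xk + (- (c * p)) * ak ≡ c * (xk + (- p) * ak)
    regroup = solve 4 (λ c xk p ak → c :* xk :+ (:- (c :* p)) :* ak := c :* (xk :+ (:- p) :* ak)) refl

  act-cong : ∀ w {x y} → x ≗ y → act D w x ≗ act D w y
  act-cong []      eq = eq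
  act-cong (s ∷ w) eq = reflect-cong s (act-cong w eq)

  act-lin : ∀ w x c y → act D w (x ⊕ c ⊙ y) ≗ act D w x ⊕ c ⊙ act D w y
  act-lin []      x c y k = refl
  act-lin (s ∷ w) x c y k =
    trans (reflect-cong s (act-lin w x c y) k) (reflect-lin s (act D w x) c (act D w y) k)

  act-scale : ∀ w c x → act D w (c ⊙ x) ≗ c ⊙ act D w x
  act-scale []      c x k = refl
  act-scale (s ∷ w) c x k = trans (reflect-cong s (act-scale w c x) k) (reflect-scale s c (act D w x) k)

  act-++ : ∀ u w x → act D (u ++ w) x ≡ act D u (act D w x)
  act-++ []      w x = refl
  act-++ (s ∷ u) w x = cong (reflect D s) (act-++ u w x)

  δ⁻¹ : Fin n → ℚ
  δ⁻¹ q = ((+ 1) ℚ./ δ D q) {{δ-nz D q}}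

  act-coroot : ∀ w q → act D w (αᵛ D q) ≗ δ⁻¹ q ⊙ act D w (α q)
  act-coroot w q k = trans (act-cong w αᵛ-scaled k) (act-scale w (δ⁻¹ q) (α q) k)
    where
    αᵛ-scaled : αᵛ D q ≗ δ⁻¹ q ⊙ α q
    αᵛ-scaled j with j == q
    ... | true  = sym (ℚP.*-identityʳ (δ⁻¹ q))
    ... | false = sym (ℚP.*-zeroʳ (δ⁻¹ q))

  -- The Euler form on V in simple-root coordinates.  Since
  -- α_j = δ(j) α_j^∨, E(α_j, α_k) = d j * e j k, and E(α_j^∨, x) is
  -- eulerRow j x.
  eulerRow : Fin n → V n → ℚ
  eulerRow j = dot (e j)

  E : V n → V n → ℚ
  E y x = dot (λ j → d j * y j) (λ j → eulerRow j x)

  E-cong : ∀ {y y' x x'} → y ≗ y' → x ≗ x' → E y x ≡ E y' x'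
  E-cong {y} {y'} {x} {x'} ey ex =
    dot-cong {λ j → d j * y j} {λ j → d j * y' j} {λ j → eulerRow j x} {λ j → eulerRow j x'}
             (λ j → cong (d j *_) (ey j)) (λ j → dot-cong {e j} {e j} (λ _ → refl) ex)

  E-linʳ : ∀ z x c y → E z (x ⊕ c ⊙ y) ≡ E z x + c * E z y
  E-linʳ z x c y = begin
    dot dz (λ j → eulerRow j (x ⊕ c ⊙ y))                     ≡⟨ dot-cong {dz} (λ _ → refl) (λ j → dot-linʳ (e j) x c y) ⟩
    dot dz ((λ j → eulerRow j x) ⊕ c ⊙ (λ j → eulerRow j y))  ≡⟨ dot-linʳ dz (λ j → eulerRow j x) c (λ j → eulerRow j y) ⟩
    E z x + c * E z y                                         ∎
    where
    open ≡-Reasoning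
    dz : Fin n → ℚ
    dz j = d j * z j

  E-linˡ : ∀ x c y z → E (x ⊕ c ⊙ y) z ≡ E x z + c * E y z
  E-linˡ x c y z = begin
    dot (λ j → d j * (x j + c * y j)) ez                      ≡⟨ dot-cong (λ j → spread (d j) (x j) (y j)) (λ _ → refl) ⟩
    dot ((λ j → d j * x j) ⊕ c ⊙ (λ j → d j * y j)) ez        ≡⟨ dot-linˡ (λ j → d j * x j) c (λ j → d j * y j) ez ⟩
    E x z + c * E y z                                         ∎
    where
    open ≡-Reasoning
    ez : Fin n → ℚ
    ez j = eulerRow j z
    spread : ∀ p q r → p * (q + c * r) ≡ p * q + c * (p * r)
    spread = solve 4 (λ c p q r → p :* (q :+ c :* r) := p :* q :+ c :* (p :* r)) refl c

  E-scaleˡ : ∀ c x z → E (c ⊙ x) z ≡ c * E x z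
  E-scaleˡ c x z = begin
    dot (λ j → d j * (c * x j)) ez      ≡⟨ dot-cong (λ j → swap (d j) c (x j)) (λ _ → refl) ⟩
    dot (c ⊙ (λ j → d j * x j)) ez      ≡⟨ dot-scaleˡ c (λ j → d j * x j) ez ⟩
    c * E x z                           ∎
    where
    open ≡-Reasoning
    ez : Fin n → ℚ
    ez j = eulerRow j z
    swap : ∀ p c q → p * (c * q) ≡ c * (p * q)
    swap = solve 3 (λ p c q → p :* (c :* q) := c :* (p :* q)) refl

  E-αˡ : ∀ i x → E (α i) x ≡ d i * eulerRow i x
  E-αˡ i x = trans (sum-cong-≗ (λ j → reorder (d j) (α i j) (eulerRow j x))) (sum-α i (λ j → d j * eulerRow j x))
    where
    reorder : ∀ p q r → (p * q) * r ≡ (p * r) * q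
    reorder = solve 3 (λ p q r → (p :* q) :* r := (p :* r) :* q) refl

  E-αʳ : ∀ i x → E x (α i) ≡ sum (λ j → (d j * x j) * e j i)
  E-αʳ i x = dot-cong {λ j → d j * x j} (λ _ → refl) (λ j → dot-α (e j) i)

  pairing-νc : ∀ x y → pairing D (νc D x) y ≡ - E y x
  pairing-νc x y = begin
    sumℚ (λ j → νc D x j * (d j * y j))                         ≡⟨ sumℚ≡sum (λ j → νc D x j * (d j * y j)) ⟩
    sum {n} (λ j → (- sumℚ (λ k → e j k * x k)) * (d j * y j))  ≡⟨ sum-cong-≗ (λ j → cong (λ s → (- s) * (d j * y j)) (sumℚ≡sum (λ k → e j k * x k))) ⟩
    sum {n} (λ j → (- eulerRow j x) * (d j * y j))              ≡⟨ sum-cong-≗ (λ j → swap (eulerRow j x) (d j * y j)) ⟩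
    sum {n} (λ j → - ((d j * y j) * eulerRow j x))              ≡⟨ sum-neg (λ j → (d j * y j) * eulerRow j x) ⟩
    - E y x                                               ∎
    where
    open ≡-Reasoning
    swap : ∀ p q → (- p) * q ≡ - (q * p)
    swap = solve 2 (λ p q → (:- p) :* q := :- (q :* p)) refl

  K : V n → V n → ℚ
  K x y = E x y + E y x

  K-cong : ∀ {x x' y y'} → x ≗ x' → y ≗ y' → K x y ≡ K x' y'
  K-cong ex ey = cong₂ _+_ (E-cong ex ey) (E-cong ey ex)

  K-sym : ∀ x y → K x y ≡ K y x
  K-sym x y = ℚP.+-comm (E x y) (E y x)

  K-linˡ : ∀ x c y z → K (x ⊕ c ⊙ y) z ≡ K x z + c * K y z
  K-linˡ x c y z = trans (cong₂ _+_ (E-linˡ x c y z) (E-linʳ z x c y))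
    (solve 5 (λ p c q r s → (p :+ c :* q) :+ (r :+ c :* s) := (p :+ r) :+ c :* (q :+ s)) refl
       (E x z) c (E y z) (E z x) (E z y))

  K-linʳ : ∀ z x c y → K z (x ⊕ c ⊙ y) ≡ K z x + c * K z y
  K-linʳ z x c y = trans (K-sym z _) (trans (K-linˡ x c y z) (cong₂ (λ p q → p + c * q) (K-sym x z) (K-sym y z)))

  A-diag : ∀ i → A i i ≡ 1ℚ + 1ℚ
  A-diag i = cong (λ b → ℤ→ℚ (if b then + 2 else ℤ.- (+ ℤ.∣ B D i i ∣))) (dec-true (i Fin.≟ i) refl)

  -- If δ(i) E(α_i^∨,α_k) + δ(k) E(α_k^∨,α_i) = δ(i) a_ik for all i, k,
  -- then K is the symmetric bilinear form of the Cartan companion, and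
  -- it is therefore invariant under the action of W.
  module Invariance (symmetrises : ∀ i k → d i * e i k + d k * e k i ≡ d i * A i k) where

    K-αˡ : ∀ i x → K (α i) x ≡ d i * cartanRow i x
    K-αˡ i x = begin
      E (α i) x + E x (α i)
        ≡⟨ cong₂ _+_ (trans (E-αˡ i x) (sym (sum-*ˡ (d i) (λ k → e i k * x k)))) (E-αʳ i x) ⟩
      sum (λ k → d i * (e i k * x k)) + sum (λ k → (d k * x k) * e k i)
        ≡⟨ ∑-distrib-+ (λ k → d i * (e i k * x k)) (λ k → (d k * x k) * e k i) ⟨
      sum (λ k → d i * (e i k * x k) + (d k * x k) * e k i)
        ≡⟨ sum-cong-≗ pointwise ⟩
      sum (λ k → d i * (A i k * x k))
        ≡⟨ sum-*ˡ (d i) (λ k → A i k * x k) ⟩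
      d i * cartanRow i x
        ∎
      where
      open ≡-Reasoning
      factor : ∀ di eik xk dk eki → di * (eik * xk) + (dk * xk) * eki ≡ (di * eik + dk * eki) * xk
      factor = solve 5 (λ di eik xk dk eki → di :* (eik :* xk) :+ (dk :* xk) :* eki := (di :* eik :+ dk :* eki) :* xk) refl
      pointwise : ∀ k → d i * (e i k * x k) + (d k * x k) * e k i ≡ d i * (A i k * x k)
      pointwise k = trans (factor (d i) (e i k) (x k) (d k) (e k i))
                          (trans (cong (_* x k) (symmetrises i k)) (ℚP.*-assoc (d i) (A i k) (x k)))

    K-αα : ∀ i → K (α i) (α i) ≡ d i * (1ℚ + 1ℚ)
    K-αα i = trans (K-αˡ i (α i)) (cong (d i *_) (trans (dot-α (A i) i) (A-diag i)))

    K-reflect : ∀ i x y → K (reflect D i x) (reflect D i y) ≡ K x y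
    K-reflect i x y = begin
      K (reflect D i x) (reflect D i y)
        ≡⟨ K-cong (reflect-eq i x) (reflect-eq i y) ⟩
      K (x ⊕ (- px) ⊙ α i) (y ⊕ (- py) ⊙ α i)
        ≡⟨ K-linˡ x (- px) (α i) (y ⊕ (- py) ⊙ α i) ⟩
      K x (y ⊕ (- py) ⊙ α i) + (- px) * K (α i) (y ⊕ (- py) ⊙ α i)
        ≡⟨ cong₂ (λ p q → p + (- px) * q) (K-linʳ x y (- py) (α i)) (K-linʳ (α i) y (- py) (α i)) ⟩
      K x y + (- py) * K x (α i) + (- px) * (K (α i) y + (- py) * K (α i) (α i))
        ≡⟨ cong (λ t → K x y + (- py) * t + (- px) * (K (α i) y + (- py) * K (α i) (α i))) (trans (K-sym x (α i)) (K-αˡ i x)) ⟩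
      K x y + (- py) * (d i * px) + (- px) * (K (α i) y + (- py) * K (α i) (α i))
        ≡⟨ cong₂ (λ p q → K x y + (- py) * (d i * px) + (- px) * (p + (- py) * q)) (K-αˡ i y) (K-αα i) ⟩
      K x y + (- py) * (d i * px) + (- px) * (d i * py + (- py) * (d i * (1ℚ + 1ℚ)))
        ≡⟨ cancel (K x y) px py (d i) ⟩
      K x y
        ∎
      where
      open ≡-Reasoning
      px py : ℚ
      px = cartanRow i x
      py = cartanRow i y
      cancel : ∀ k p q δi → k + (- q) * (δi * p) + (- p) * (δi * q + (- q) * (δi * (1ℚ + 1ℚ))) ≡ k
      cancel = solve 4 (λ k p q δi →
        k :+ (:- q) :* (δi :* p) :+ (:- p) :* (δi :* q :+ (:- q) :* (δi :* (con 1ℚ :+ con 1ℚ))) := k) refl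

    K-act : ∀ w x y → K (act D w x) (act D w y) ≡ K x y
    K-act []      x y = refl
    K-act (s ∷ w) x y = trans (K-reflect s (act D w x) (act D w y)) (K-act w x y)

  E-expand : ∀ x u y z v t → E (x ⊕ u ⊙ y) (z ⊕ v ⊙ t) ≡ E x z + v * E x t + u * (E y z + v * E y t)
  E-expand x u y z v t =
    trans (E-linˡ x u y (z ⊕ v ⊙ t)) (cong₂ (λ p q → p + u * q) (E-linʳ x z v t) (E-linʳ y z v t))

-- Skew-symmetrizability makes K the W-invariant form of the Cartan
-- companion; the indexing b_ij > 0 ⇒ i < j makes E upper triangular.
module Symmetrizable {n : ℕ} (D : SkewData n) (skew : SkewSymmetrizable D) where

  open Geometry D
  open import Data.Rational using (_+_; _*_)
  open ℚSolver.+-*-Solver using (solve; _:+_; _:*_; con; _:=_)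

  private
    euler-off : ∀ {i k} → i ≢ k → euler D i k ≡ B D i k ℤ.⊓ + 0
    euler-off {i} {k} i≢k = cong (λ b → if b then + 1 else B D i k ℤ.⊓ + 0) (dec-false (i Fin.≟ k) i≢k)

  euler-symmetrisesℤ : ∀ i k →
    + δ D i ℤ.* euler D i k ℤ.+ + δ D k ℤ.* euler D k i ≡ + δ D i ℤ.* cartan D i k
  euler-symmetrisesℤ i k with i Fin.≟ k
  ... | yes refl rewrite dec-true (i Fin.≟ i) refl =
    sym (ℤP.*-distribˡ-+ (+ δ D i) (+ 1) (+ 1))
  ... | no i≢k =
    trans (cong (λ z → + δ D i ℤ.* (B D i k ℤ.⊓ + 0) ℤ.+ + δ D k ℤ.* z) (euler-off (i≢k ∘ sym)))
          (negative-parts (δ D i) (δ D k) {{δ-nz D i}} {{δ-nz D k}} (B D i k) (B D k i) (skew i k))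

  euler-symmetrises : ∀ i k → d i * e i k + d k * e k i ≡ d i * A i k
  euler-symmetrises i k = begin
    d i * e i k + d k * e k i                                             ≡⟨ cong₂ _+_ (ℤ→ℚ-* (+ δ D i) (euler D i k)) (ℤ→ℚ-* (+ δ D k) (euler D k i)) ⟨
    ℤ→ℚ (+ δ D i ℤ.* euler D i k) + ℤ→ℚ (+ δ D k ℤ.* euler D k i)        ≡⟨ ℤ→ℚ-+ (+ δ D i ℤ.* euler D i k) (+ δ D k ℤ.* euler D k i) ⟨
    ℤ→ℚ (+ δ D i ℤ.* euler D i k ℤ.+ + δ D k ℤ.* euler D k i)            ≡⟨ cong ℤ→ℚ (euler-symmetrisesℤ i k) ⟩
    ℤ→ℚ (+ δ D i ℤ.* cartan D i k)                                        ≡⟨ ℤ→ℚ-* (+ δ D i) (cartan D i k) ⟩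
    d i * A i k                                                           ∎
    where open ≡-Reasoning

  open Invariance euler-symmetrises public

  E-root-self : ∀ w i → E (act D w (α i)) (act D w (α i)) ≡ d i
  E-root-self w i = halve (begin
    E β β + E β β          ≡⟨ K-act w (α i) (α i) ⟩
    K (α i) (α i)          ≡⟨ K-αα i ⟩
    d i * (1ℚ + 1ℚ)        ≡⟨ solve 1 (λ x → x :* (con 1ℚ :+ con 1ℚ) := x :+ x) refl (d i) ⟩
    d i + d i              ∎)
    where
    open ≡-Reasoning
    β : V n
    β = act D w (α i)
    halve : ∀ {x y} → x + x ≡ y + y → x ≡ y
    halve {x} {y} eq = trans (half x) (trans (cong (_* ℚ.½) eq) (sym (half y)))
      where
      half : ∀ z → z ≡ (z + z) * ℚ.½
      half = solve 1 (λ z → z := (z :+ z) :* con ℚ.½) refl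

  K-roots : ∀ w j i → K (act D w (α j)) (act D w (α i)) ≡ d i * A i j
  K-roots w j i = begin
    K (act D w (α j)) (act D w (α i))   ≡⟨ K-act w (α j) (α i) ⟩
    K (α j) (α i)                       ≡⟨ K-sym (α j) (α i) ⟩
    K (α i) (α j)                       ≡⟨ K-αˡ i (α j) ⟩
    d i * cartanRow i (α j)             ≡⟨ cong (d i *_) (dot-α (A i) j) ⟩
    d i * A i j                         ∎
    where open ≡-Reasoning

  E-upper : IndexedCompatibly D → ∀ {a b} → a Fin.< b → E (α a) (α b) ≡ 0ℚ
  E-upper compatible {a} {b} a<b = begin
    E (α a) (α b)                ≡⟨ E-αˡ a (α b) ⟩
    d a * eulerRow a (α b)       ≡⟨ cong (d a *_) (dot-α (e a) b) ⟩
    d a * ℤ→ℚ (euler D a b)      ≡⟨ cong (λ z → d a * ℤ→ℚ z) (trans (euler-off a≢b) (ℤP.i≥j⇒i⊓j≡j b-nonneg)) ⟩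
    d a * 0ℚ                     ≡⟨ ℚP.*-zeroʳ (d a) ⟩
    0ℚ                           ∎
    where
    open ≡-Reasoning
    a≢b : a ≢ b
    a≢b refl = ℕP.<-irrefl refl a<b
    b-nonneg : + 0 ℤ.≤ B D a b
    b-nonneg = ℤP.≮⇒≥ λ b<0 →
      ℕP.<-asym a<b (compatible b a (neg⇒pos (δ D a) (δ D b) {{δ-nz D a}} {{δ-nz D b}} (skew a b) b<0))

module Positions {n : ℕ} where

  open import Data.Nat using (_<_; _≤_; _∸_)
  open import Data.List.Membership.Propositional using (_∈_; _∉_)
  open import Data.List.Membership.Propositional.Properties using (∈-++⁺ˡ; ∈-++⁺ʳ; ∈-++⁻)
  open import Data.List.Relation.Unary.All as All using (All; []; _∷_)
  import Data.List.Relation.Unary.All.Properties as AllP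
  open import Data.List.Relation.Unary.AllPairs using (AllPairs; []; _∷_)
  open import Data.List.Relation.Unary.Any using (here; there)
  open import Data.Bool.Properties using (T?)
  open import Data.Unit using (tt)
  open import Function.Bundles using (Equivalence)
  open import Relation.Binary.Definitions using (tri<; tri≈; tri>)

  infix 4 _≺_

  data _≺_ : Pos n → Pos n → Set where
    earlier-copy : ∀ {k k' i i'} → k < k' → (k , i) ≺ (k' , i')
    same-copy    : ∀ {k i i'} → toℕ i < toℕ i' → (k , i) ≺ (k , i')

  <P⇒≺ : ∀ {p q : Pos n} → p <P q → p ≺ q
  <P⇒≺ {k , i} {k' , i'} h with Equivalence.to BoolP.T-∨ h
  ... | inj₁ k<k' = earlier-copy (ℕP.<ᵇ⇒< k k' k<k')
  ... | inj₂ same with Equivalence.to BoolP.T-∧ same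
  ...   | k≡k' , i<i' with ℕP.≡ᵇ⇒≡ k k' k≡k'
  ...     | refl = same-copy (ℕP.<ᵇ⇒< (toℕ i) (toℕ i') i<i')

  ≺⇒<P : ∀ {p q : Pos n} → p ≺ q → p <P q
  ≺⇒<P (earlier-copy k<k') = Equivalence.from BoolP.T-∨ (inj₁ (ℕP.<⇒<ᵇ k<k'))
  ≺⇒<P {k , _} (same-copy i<i') =
    Equivalence.from BoolP.T-∨ (inj₂ (Equivalence.from BoolP.T-∧ (ℕP.≡⇒≡ᵇ k k refl , ℕP.<⇒<ᵇ i<i')))

  ≺-trans : ∀ {p q r : Pos n} → p ≺ q → q ≺ r → p ≺ r
  ≺-trans (earlier-copy x) (earlier-copy y) = earlier-copy (ℕP.<-trans x y)
  ≺-trans (earlier-copy x) (same-copy y)    = earlier-copy x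
  ≺-trans (same-copy x)    (earlier-copy y) = earlier-copy y
  ≺-trans (same-copy x)    (same-copy y)    = same-copy (ℕP.<-trans x y)

  ≺-irrefl : ∀ {p : Pos n} → ¬ p ≺ p
  ≺-irrefl (earlier-copy x) = ℕP.<-irrefl refl x
  ≺-irrefl (same-copy x)    = ℕP.<-irrefl refl x

  ≺-asym : ∀ {p q : Pos n} → p ≺ q → ¬ q ≺ p
  ≺-asym p≺q q≺p = ≺-irrefl (≺-trans p≺q q≺p)

  ≺-connex : ∀ (p q : Pos n) → p ≢ q → p ≺ q ⊎ q ≺ p
  ≺-connex (k , i) (k' , i') p≢q with ℕP.<-cmp k k'
  ... | tri< k<k' _ _ = inj₁ (earlier-copy k<k')
  ... | tri> _ _ k>k' = inj₂ (earlier-copy k>k')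
  ... | tri≈ _ refl _ with ℕP.<-cmp (toℕ i) (toℕ i')
  ...   | tri< i<i' _ _ = inj₁ (same-copy i<i')
  ...   | tri> _ _ i>i' = inj₂ (same-copy i>i')
  ...   | tri≈ _ i≡i' _ = ⊥-elim (p≢q (cong (k ,_) (FinP.toℕ-injective i≡i')))

  <P-trans : ∀ {p q r : Pos n} → p <P q → q <P r → p <P r
  <P-trans {p} {q} {r} p<q q<r = ≺⇒<P {p} {r} (≺-trans (<P⇒≺ {p} {q} p<q) (<P⇒≺ {q} {r} q<r))

  private
    =ᵖ-refl : ∀ (p : Pos n) → T (p =ᵖ p)
    =ᵖ-refl (k , i) rewrite dec-true (i Fin.≟ i) refl = Equivalence.from BoolP.T-∧ (ℕP.≡⇒≡ᵇ k k refl , tt)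

    =ᵖ-sound : ∀ (p q : Pos n) → T (p =ᵖ q) → p ≡ q
    =ᵖ-sound (k , i) (k' , i') h with Equivalence.to BoolP.T-∧ h
    ... | k≡k' , i≡i' with ℕP.≡ᵇ⇒≡ k k' k≡k' | i Fin.≟ i'
    ...   | refl | yes refl = refl
    ...   | refl | no _     = ⊥-elim i≡i'

  memberᵖ-∈ : ∀ (p : Pos n) ps → p ∈ ps → memberᵖ p ps ≡ true
  memberᵖ-∈ p (x ∷ ps) (here refl) = Equivalence.to BoolP.T-≡ (Equivalence.from BoolP.T-∨ (inj₁ (=ᵖ-refl p)))
  memberᵖ-∈ p (x ∷ ps) (there m) =
    Equivalence.to BoolP.T-≡ (Equivalence.from BoolP.T-∨ (inj₂ (Equivalence.from BoolP.T-≡ (memberᵖ-∈ p ps m))))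

  memberᵖ-∉ : ∀ (p : Pos n) ps → p ∉ ps → memberᵖ p ps ≡ false
  memberᵖ-∉ p []       _   = refl
  memberᵖ-∉ p (x ∷ ps) p∉ with p =ᵖ x in eq
  ... | true  = ⊥-elim (p∉ (here (=ᵖ-sound p x (subst T (sym eq) tt))))
  ... | false = memberᵖ-∉ p ps (p∉ ∘ there)

  Sorted : List (Pos n) → Set
  Sorted = AllPairs _<P_

  FirstFree : List (Pos n) → Fin n → ℕ → Set
  FirstFree ps q K = (∀ k → k < K → (k , q) ∈ ps) × (K , q) ∉ ps

  -- A sorted list containing (k , q) for k₀ ≤ k < K has at least K ∸ k₀
  -- entries; this is why the fuel length ps in firstFreeFrom suffices.
  occupied-length : ∀ {xs} → Sorted xs → ∀ q K k₀ →
                    (∀ k → k₀ ≤ k → k < K → (k , q) ∈ xs) → K ∸ k₀ ≤ length xs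
  occupied-length {[]} _ q K k₀ occ with k₀ ℕP.<? K
  ... | yes k₀<K with () ← occ k₀ ℕP.≤-refl k₀<K
  ... | no k₀≮K = ℕP.≤-reflexive (ℕP.m≤n⇒m∸n≡0 (ℕP.≮⇒≥ k₀≮K))
  occupied-length {x ∷ xs} (x<xs ∷ sorted) q K k₀ occ with k₀ ℕP.<? K
  ... | no k₀≮K = ℕP.≤-trans (ℕP.≤-reflexive (ℕP.m≤n⇒m∸n≡0 (ℕP.≮⇒≥ k₀≮K))) z≤n
  ... | yes k₀<K with occ k₀ ℕP.≤-refl k₀<K
  ...   | here refl =
          ℕP.≤-trans (ℕP.≤-reflexive (ℕP.+-∸-assoc 1 k₀<K)) (s≤s (occupied-length sorted q K (suc k₀) occ'))
    where
    occ' : ∀ k → suc k₀ ≤ k → k < K → (k , q) ∈ xs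
    occ' k k₀<k k<K with occ k (ℕP.<⇒≤ k₀<k) k<K
    ... | here eq = ⊥-elim (ℕP.<-irrefl (sym (cong proj₁ eq)) k₀<k)
    ... | there m = m
  ...   | there m₀ = ℕP.m≤n⇒m≤1+n (occupied-length sorted q K k₀ occ')
    where
    x≺k₀ : x ≺ (k₀ , q)
    x≺k₀ = <P⇒≺ (All.lookup x<xs m₀)
    occ' : ∀ k → k₀ ≤ k → k < K → (k , q) ∈ xs
    occ' k k₀≤k k<K with occ k k₀≤k k<K
    ... | there m = m
    ... | here eq with ℕP.m≤n⇒m<n∨m≡n k₀≤k
    ...   | inj₁ k₀<k = ⊥-elim (≺-asym x≺k₀ (subst ((k₀ , q) ≺_) eq (earlier-copy k₀<k)))
    ...   | inj₂ refl = ⊥-elim (≺-irrefl (subst (_≺ (k₀ , q)) (sym eq) x≺k₀))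

  private
    firstFreeFrom-finds : ∀ ps q K → FirstFree ps q K → ∀ f k₀ → k₀ ≤ K → K ≤ k₀ ℕ.+ f →
                          firstFreeFrom f k₀ q ps ≡ K
    firstFreeFrom-finds ps q K ff zero k₀ k₀≤K K≤k₀ =
      ℕP.≤-antisym k₀≤K (ℕP.≤-trans K≤k₀ (ℕP.≤-reflexive (ℕP.+-identityʳ k₀)))
    firstFreeFrom-finds ps q K ff (suc f) k₀ k₀≤K K≤k₀+f with ℕP.m≤n⇒m<n∨m≡n k₀≤K
    ... | inj₂ refl rewrite memberᵖ-∉ (k₀ , q) ps (proj₂ ff) = refl
    ... | inj₁ k₀<K rewrite memberᵖ-∈ (k₀ , q) ps (proj₁ ff k₀ k₀<K) =
      firstFreeFrom-finds ps q K ff f (suc k₀) k₀<K (ℕP.≤-trans K≤k₀+f (ℕP.≤-reflexive (ℕP.+-suc k₀ f)))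

  leftmostFree-correct : ∀ {ps q K} → Sorted ps → FirstFree ps q K → leftmostFree q ps ≡ (K , q)
  leftmostFree-correct {ps} {q} {K} sorted ff =
    cong (_, q) (firstFreeFrom-finds ps q K ff (length ps) 0 z≤n
                   (occupied-length sorted q K 0 (λ k _ k<K → proj₁ ff k k<K)))

  sorted-snoc : ∀ xs (p : Pos n) → Sorted (xs ++ p ∷ []) → Sorted xs × All (_≺ p) xs
  sorted-snoc []       p _                 = [] , []
  sorted-snoc (x ∷ xs) p (x<rest ∷ sorted) with sorted-snoc xs p sorted
  ... | sorted-xs , xs≺p = (AllP.++⁻ˡ xs x<rest ∷ sorted-xs) , (x≺p (AllP.++⁻ʳ xs x<rest) ∷ xs≺p)
    where
    x≺p : All (x <P_) (p ∷ []) → x ≺ p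
    x≺p (x<p ∷ []) = <P⇒≺ x<p

  all-≺⇒∉ : ∀ {xs} {p : Pos n} → All (_≺ p) xs → p ∉ xs
  all-≺⇒∉ (p≺p ∷ _)   (here refl) = ≺-irrefl p≺p
  all-≺⇒∉ (_ ∷ xs≺p) (there m)   = all-≺⇒∉ xs≺p m

  ∈-snoc : ∀ {xs} {p y : Pos n} → y ∈ xs ++ p ∷ [] → y ∈ xs ⊎ y ≡ p
  ∈-snoc {xs} m with ∈-++⁻ xs m
  ... | inj₁ m'        = inj₁ m'
  ... | inj₂ (here eq) = inj₂ eq

  lettersBefore : Pos n → List (Pos n) → Word n
  lettersBefore φ xs = letters (filter (λ x → T? (x <ᵖ φ)) xs)

  lettersBefore-snoc-later : ∀ φ xs (p : Pos n) → φ ≺ p → lettersBefore φ (xs ++ p ∷ []) ≡ lettersBefore φ xs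
  lettersBefore-snoc-later φ xs p φ≺p = cong letters (begin
    filter P? (xs ++ p ∷ [])          ≡⟨ ListP.filter-++ P? xs (p ∷ []) ⟩
    filter P? xs ++ filter P? (p ∷ [])  ≡⟨ cong (filter P? xs ++_) (ListP.filter-reject P? {xs = []} (λ p<φ → ≺-asym φ≺p (<P⇒≺ p<φ))) ⟩
    filter P? xs ++ []                ≡⟨ ListP.++-identityʳ (filter P? xs) ⟩
    filter P? xs                      ∎)
    where
    open ≡-Reasoning
    P? = λ x → T? (x <ᵖ φ)

  lettersBefore-all : ∀ φ xs → All (_≺ φ) xs → lettersBefore φ xs ≡ letters xs
  lettersBefore-all φ xs xs≺φ = cong letters (ListP.filter-all (λ x → T? (x <ᵖ φ)) (All.map ≺⇒<P xs≺φ))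

  lettersBefore-snoc-earlier : ∀ φ xs (p : Pos n) → All (_≺ φ) xs → p ≺ φ →
                               lettersBefore φ (xs ++ p ∷ []) ≡ letters xs ++ proj₂ p ∷ []
  lettersBefore-snoc-earlier φ xs p xs≺φ p≺φ =
    trans (lettersBefore-all φ (xs ++ p ∷ []) (AllP.++⁺ xs≺φ (p≺φ ∷ []))) (ListP.map-++ proj₂ xs (p ∷ []))

  csortable-init : ∀ xs (p : Pos n) → All (_≺ p) xs → CSortableWord (xs ++ p ∷ []) → CSortableWord xs
  csortable-init xs p xs≺p sortable k i m with ∈-snoc {xs} (sortable k i (∈-++⁺ˡ m))
  ... | inj₁ m'   = m'
  ... | inj₂ refl = ⊥-elim (later-copy (All.lookup xs≺p m))
    where
    later-copy : ¬ (suc k , i) ≺ (k , i)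
    later-copy (earlier-copy k+1<k) = ℕP.<-asym k+1<k (ℕP.n<1+n k)

  csortable-down : ∀ ps (i : Fin n) m k → CSortableWord ps → (m ℕ.+ k , i) ∈ ps → (k , i) ∈ ps
  csortable-down ps i zero    k sortable m∈ = m∈
  csortable-down ps i (suc m) k sortable m∈ = csortable-down ps i m k sortable (sortable (m ℕ.+ k) i m∈)

  -- The letter i of the last position (t , i) is used in all copies
  -- before t, so t is its first free copy in xs and t + 1 in xs ++ [(t , i)].
  firstFree-last : ∀ xs t i → All (_≺ (t , i)) xs → CSortableWord (xs ++ (t , i) ∷ []) → FirstFree xs i t
  firstFree-last xs t i xs≺p sortable = used , all-≺⇒∉ xs≺p
    where
    used : ∀ k → k < t → (k , i) ∈ xs
    used k k<t with ∈-snoc {xs} (csortable-down (xs ++ (t , i) ∷ []) i (t ∸ k) k sortable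
                     (subst (λ z → (z , i) ∈ xs ++ (t , i) ∷ []) (sym (ℕP.m∸n+n≡m (ℕP.<⇒≤ k<t))) (∈-++⁺ʳ xs (here refl))))
    ... | inj₁ m  = m
    ... | inj₂ eq = ⊥-elim (ℕP.<-irrefl (cong proj₁ eq) k<t)

  firstFree-after-last : ∀ xs t i → All (_≺ (t , i)) xs → CSortableWord (xs ++ (t , i) ∷ []) →
                         FirstFree (xs ++ (t , i) ∷ []) i (suc t)
  firstFree-after-last xs t i xs≺p sortable = used , unused
    where
    used : ∀ k → k < suc t → (k , i) ∈ xs ++ (t , i) ∷ []
    used k k<t+1 with ℕP.m≤n⇒m<n∨m≡n (ℕP.≤-pred k<t+1)
    ... | inj₁ k<t  = ∈-++⁺ˡ (proj₁ (firstFree-last xs t i xs≺p sortable) k k<t)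
    ... | inj₂ refl = ∈-++⁺ʳ xs (here refl)
    unused : (suc t , i) ∉ xs ++ (t , i) ∷ []
    unused m with ∈-snoc {xs} m
    ... | inj₂ eq = ℕP.<-irrefl (cong proj₁ (sym eq)) (ℕP.n<1+n t)
    ... | inj₁ m' with All.lookup xs≺p m'
    ...   | earlier-copy t+1<t = ℕP.<-asym t+1<t (ℕP.n<1+n t)

  firstFree-other : ∀ xs (p : Pos n) q K → q ≢ proj₂ p → FirstFree xs q K → FirstFree (xs ++ p ∷ []) q K
  firstFree-other xs p q K q≢i (used , unused) = (λ k k<K → ∈-++⁺ˡ (used k k<K)) , unused'
    where
    unused' : (K , q) ∉ xs ++ p ∷ []
    unused' m with ∈-snoc {xs} m
    ... | inj₁ m' = unused m'
    ... | inj₂ eq = q≢i (cong proj₂ eq)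

  -- No letter b ≠ i has its first free position after (t + 1 , i): that
  -- would force (t + 1 , b) or (t , b) to occur after the last position.
  nothing-after-last : ∀ xs t i b K → All (_≺ (t , i)) xs → FirstFree (xs ++ (t , i) ∷ []) b K →
                       b ≢ i → ¬ (suc t , i) ≺ (K , b)
  nothing-after-last xs t i b K xs≺p (used , _) b≢i (earlier-copy t+1<K) with ∈-snoc {xs} (used (suc t) t+1<K)
  ... | inj₂ eq = ℕP.<-irrefl (cong proj₁ (sym eq)) (ℕP.n<1+n t)
  ... | inj₁ m with All.lookup xs≺p m
  ...   | earlier-copy t+1<t = ℕP.<-asym t+1<t (ℕP.n<1+n t)
  nothing-after-last xs t i b (suc t) xs≺p (used , _) b≢i (same-copy i<b) with ∈-snoc {xs} (used t (ℕP.n<1+n t))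
  ... | inj₂ eq = b≢i (cong proj₂ eq)
  ... | inj₁ m with All.lookup xs≺p m
  ...   | earlier-copy t<t = ℕP.<-irrefl refl t<t
  ...   | same-copy b<i   = ℕP.<-asym i<b b<i

prefixBeforeLast-snoc-same : ∀ {n} (r : Fin n) w → prefixBeforeLast r (w ++ r ∷ []) ≡ just w
prefixBeforeLast-snoc-same r []      rewrite dec-true (r Fin.≟ r) refl = refl
prefixBeforeLast-snoc-same r (s ∷ w) rewrite prefixBeforeLast-snoc-same r w = refl

prefixBeforeLast-snoc-other : ∀ {n} (r i : Fin n) w → i ≢ r →
                              prefixBeforeLast r (w ++ i ∷ []) ≡ prefixBeforeLast r w
prefixBeforeLast-snoc-other r i []      i≢r rewrite dec-false (i Fin.≟ r) i≢r = refl
prefixBeforeLast-snoc-other r i (s ∷ w) i≢r rewrite prefixBeforeLast-snoc-other r i w i≢r = refl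

clFrom : ∀ {n} → SkewData n → Fin n → Maybe (Word n) → V n
clFrom D r nothing  = λ k → ℚ.- α r k
clFrom D r (just u) = act D u (α r)

cl-clFrom : ∀ {n} (D : SkewData n) r ps → cl D r ps ≡ clFrom D r (prefixBeforeLast r (letters ps))
cl-clFrom D r ps with prefixBeforeLast r (letters ps)
... | nothing = refl
... | just u  = refl

module Invariant {n : ℕ} (D : SkewData n) (skew : SkewSymmetrizable D)
                 (compatible : IndexedCompatibly D) where

  open Geometry D
  open Symmetrizable D skew
  open Positions {n}
  open import Data.Rational using (_+_; _*_; -_)
  open import Data.List.Membership.Propositional using (_∈_)
  open import Data.List.Membership.Propositional.Properties using (∈-++⁻)
  open import Data.List.Relation.Unary.All as All using (All)
  open import Data.List.Relation.Unary.Any using (here)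
  open ℚSolver.+-*-Solver using (solve; _:+_; _:*_; :-_; con; _:=_)

  target : Fin n → Fin n → ℚ
  target q r = if q == r then - d q else 0ℚ

  target-off : ∀ {q r} → q ≢ r → target q r ≡ 0ℚ
  target-off {q} {r} q≢r = cong (λ b → if b then - d q else 0ℚ) (dec-false (q Fin.≟ r) q≢r)

  Cc-at : ∀ q ps φ → leftmostFree q ps ≡ φ → Cc D q ps ≡ act D (lettersBefore φ ps) (α q)
  Cc-at q ps φ eq = cong (λ z → act D (lettersBefore z ps) (α q)) eq

  FirstFreeAll : List (Pos n) → Set
  FirstFreeAll ps = ∀ q → ∃ (FirstFree ps q)

  Triangular : List (Pos n) → Set
  Triangular ps = ∀ a b → leftmostFree a ps ≺ leftmostFree b ps → E (Cc D a ps) (Cc D b ps) ≡ 0ℚ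

  Dual : List (Pos n) → Set
  Dual ps = ∀ r → r ∈ letters ps → ∀ q → E (Cc D q ps) (cl D r ps) ≡ target q r

  Holds : List (Pos n) → Set
  Holds ps = Sorted ps → CSortableWord ps → FirstFreeAll ps × Triangular ps × Dual ps

  holds-[] : Holds []
  holds-[] _ _ = (λ q → 0 , (λ k ()) , (λ ())) , triangular , (λ r ())
    where
    triangular : Triangular []
    triangular a b (same-copy a<b) = E-upper compatible a<b

  target-normalised : ∀ q r → - (δ⁻¹ q * target q r) ≡ (if q == r then 1ℚ else 0ℚ)
  target-normalised q r with q Fin.≟ r
  ... | yes refl = trans (solve 2 (λ c δq → :- (c :* (:- δq)) := c :* δq) refl (δ⁻¹ q) (d q))
                         (reciprocal-cancel (δ D q) {{δ-nz D q}})
  ... | no _     = cong -_ (ℚP.*-zeroʳ (δ⁻¹ q))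

  -- Write w for the letters
  -- of xs and β = w α_i.  Letters q whose first free position stays
  -- before p keep C_q; for the others C_q(ps) = C_q(xs) − a_iq β.
  module Extension (xs : List (Pos n)) (t : ℕ) (i : Fin n)
                   (sorted : Sorted (xs ++ (t , i) ∷ []))
                   (sortable : CSortableWord (xs ++ (t , i) ∷ []))
                   (holds-xs : Holds xs) where

    p : Pos n
    p = (t , i)

    ps : List (Pos n)
    ps = xs ++ p ∷ []

    xs≺p : All (_≺ p) xs
    xs≺p = proj₂ (sorted-snoc xs p sorted)

    sorted-xs : Sorted xs
    sorted-xs = proj₁ (sorted-snoc xs p sorted)

    private
      invariant-xs : FirstFreeAll xs × Triangular xs × Dual xs
      invariant-xs = holds-xs sorted-xs (csortable-init xs p xs≺p sortable)

    firstFree-xs : FirstFreeAll xs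
    firstFree-xs = proj₁ invariant-xs

    triangular-xs : Triangular xs
    triangular-xs = proj₁ (proj₂ invariant-xs)

    dual-xs : Dual xs
    dual-xs = proj₂ (proj₂ invariant-xs)

    w : Word n
    w = letters xs

    β : V n
    β = act D w (α i)

    Kq : Fin n → ℕ
    Kq q = proj₁ (firstFree-xs q)

    lf-i-xs : leftmostFree i xs ≡ p
    lf-i-xs = leftmostFree-correct sorted-xs (firstFree-last xs t i xs≺p sortable)

    lf-i-ps : leftmostFree i ps ≡ (suc t , i)
    lf-i-ps = leftmostFree-correct sorted (firstFree-after-last xs t i xs≺p sortable)

    lf-xs : ∀ q → leftmostFree q xs ≡ (Kq q , q)
    lf-xs q = leftmostFree-correct sorted-xs (proj₂ (firstFree-xs q))

    lf-ps : ∀ q → q ≢ i → leftmostFree q ps ≡ (Kq q , q)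
    lf-ps q q≢i = leftmostFree-correct sorted (firstFree-other xs p q (Kq q) q≢i (proj₂ (firstFree-xs q)))

    Cc-xs-late : ∀ q φ → leftmostFree q xs ≡ φ → All (_≺ φ) xs → Cc D q xs ≗ act D w (α q)
    Cc-xs-late q φ eq xs≺φ k = cong (λ u → act D u (α q) k) (trans (cong (λ z → lettersBefore z xs) eq)
                                                               (lettersBefore-all φ xs xs≺φ))

    Cc-i-xs : Cc D i xs ≗ β
    Cc-i-xs = Cc-xs-late i p lf-i-xs xs≺p

    Cc-ps-late : ∀ q φ → leftmostFree q ps ≡ φ → p ≺ φ → Cc D q ps ≗ act D w (α q) ⊕ (- A i q) ⊙ β
    Cc-ps-late q φ eq p≺φ k = begin
      Cc D q ps k                                          ≡⟨ cong (λ z → z k) (Cc-at q ps φ eq) ⟩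
      act D (lettersBefore φ ps) (α q) k                   ≡⟨ cong (λ u → act D u (α q) k) (lettersBefore-snoc-earlier φ xs p (All.map (λ x≺p → ≺-trans x≺p p≺φ) xs≺p) p≺φ) ⟩
      act D (w ++ i ∷ []) (α q) k                          ≡⟨ cong (λ z → z k) (act-++ w (i ∷ []) (α q)) ⟩
      act D w (reflect D i (α q)) k                        ≡⟨ act-cong w (reflect-eq i (α q)) k ⟩
      act D w (α q ⊕ (- cartanRow i (α q)) ⊙ α i) k        ≡⟨ act-lin w (α q) (- cartanRow i (α q)) (α i) k ⟩
      act D w (α q) k + (- cartanRow i (α q)) * β k        ≡⟨ cong (λ z → act D w (α q) k + (- z) * β k) (dot-α (A i) q) ⟩
      act D w (α q) k + (- A i q) * β k                    ∎
      where open ≡-Reasoning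

    data Placement (q : Fin n) : Set where
      before : leftmostFree q ps ≺ p → leftmostFree q xs ≡ leftmostFree q ps →
               Cc D q ps ≗ Cc D q xs → q ≢ i → Placement q
      after  : p ≺ leftmostFree q ps → (q ≢ i → leftmostFree q xs ≡ leftmostFree q ps) →
               Cc D q ps ≗ Cc D q xs ⊕ (- A i q) ⊙ β → Cc D q xs ≗ act D w (α q) → Placement q

    placement : ∀ q → Placement q
    placement q with q Fin.≟ i
    ... | yes refl =
      after (subst (p ≺_) (sym lf-i-ps) p≺t+1) (λ q≢q → ⊥-elim (q≢q refl))
            (λ k → trans (Cc-ps-late q (suc t , q) lf-i-ps p≺t+1 k) (cong (λ z → z + (- A q q) * β k) (sym (Cc-i-xs k))))
            Cc-i-xs
      where
      p≺t+1 : p ≺ (suc t , i)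
      p≺t+1 = earlier-copy (ℕP.n<1+n t)
    ... | no q≢i with ≺-connex (Kq q , q) p (λ eq → q≢i (cong proj₂ eq))
    ...   | inj₁ Kq≺p =
      before (subst (_≺ p) (sym (lf-ps q q≢i)) Kq≺p) (trans (lf-xs q) (sym (lf-ps q q≢i)))
             (λ k → cong (λ z → z k) (begin
               Cc D q ps                                   ≡⟨ Cc-at q ps (Kq q , q) (lf-ps q q≢i) ⟩
               act D (lettersBefore (Kq q , q) ps) (α q)    ≡⟨ cong (λ u → act D u (α q)) (lettersBefore-snoc-later (Kq q , q) xs p Kq≺p) ⟩
               act D (lettersBefore (Kq q , q) xs) (α q)    ≡⟨ Cc-at q xs (Kq q , q) (lf-xs q) ⟨
               Cc D q xs                                   ∎))
             q≢i
      where open ≡-Reasoning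
    ...   | inj₂ p≺Kq =
      after (subst (p ≺_) (sym (lf-ps q q≢i)) p≺Kq) (λ _ → trans (lf-xs q) (sym (lf-ps q q≢i)))
            (λ k → trans (Cc-ps-late q (Kq q , q) (lf-ps q q≢i) p≺Kq k) (cong (λ z → z + (- A i q) * β k) (sym (late k))))
            late
      where
      late : Cc D q xs ≗ act D w (α q)
      late = Cc-xs-late q (Kq q , q) (lf-xs q) (All.map (λ x≺p → ≺-trans x≺p p≺Kq) xs≺p)

    E-β-late : ∀ q → p ≺ leftmostFree q xs → E β (Cc D q xs) ≡ 0ℚ
    E-β-late q p≺q = trans (E-cong (λ k → sym (Cc-i-xs k)) (λ _ → refl))
                           (triangular-xs i q (subst (_≺ leftmostFree q xs) (sym lf-i-xs) p≺q))

    E-early-β : ∀ q → leftmostFree q xs ≺ p → E (Cc D q xs) β ≡ 0ℚ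
    E-early-β q q≺p = trans (E-cong (λ _ → refl) (λ k → sym (Cc-i-xs k)))
                            (triangular-xs q i (subst (leftmostFree q xs ≺_) (sym lf-i-xs) q≺p))

    -- For a later root w α_q, W-invariance of K then gives E(w α_q, β) = δ(i) a_iq.
    E-late-β : ∀ q → Cc D q xs ≗ act D w (α q) → E β (Cc D q xs) ≡ 0ℚ → E (Cc D q xs) β ≡ d i * A i q
    E-late-β q late β⊥q = begin
      E (Cc D q xs) β                        ≡⟨ ℚP.+-identityʳ (E (Cc D q xs) β) ⟨
      E (Cc D q xs) β + 0ℚ                   ≡⟨ cong (_+_ (E (Cc D q xs) β)) β⊥q ⟨
      K (Cc D q xs) β                        ≡⟨ K-cong late (λ _ → refl) ⟩
      K (act D w (α q)) β                    ≡⟨ K-roots w q i ⟩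
      d i * A i q                            ∎
      where open ≡-Reasoning

    precedes-late : ∀ b → p ≺ leftmostFree b ps → (b ≢ i → leftmostFree b xs ≡ leftmostFree b ps) →
                    ∀ {φ} → φ ≺ p → φ ≺ leftmostFree b xs
    precedes-late b p≺b eb φ≺p with b Fin.≟ i
    ... | yes refl = subst (_ ≺_) (sym lf-i-xs) φ≺p
    ... | no b≢i   = subst (_ ≺_) (sym (eb b≢i)) (≺-trans φ≺p p≺b)

    triangular-early-late : ∀ a b → Cc D a ps ≗ Cc D a xs → leftmostFree a xs ≺ p →
                            leftmostFree a xs ≺ leftmostFree b xs → Cc D b ps ≗ Cc D b xs ⊕ (- A i b) ⊙ β →
                            E (Cc D a ps) (Cc D b ps) ≡ 0ℚ
    triangular-early-late a b Ca a≺p a≺b Cb = begin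
      E (Cc D a ps) (Cc D b ps)                                   ≡⟨ E-cong Ca Cb ⟩
      E (Cc D a xs) (Cc D b xs ⊕ (- A i b) ⊙ β)                   ≡⟨ E-linʳ (Cc D a xs) (Cc D b xs) (- A i b) β ⟩
      E (Cc D a xs) (Cc D b xs) + (- A i b) * E (Cc D a xs) β     ≡⟨ cong₂ (λ x y → x + (- A i b) * y) (triangular-xs a b a≺b) (E-early-β a a≺p) ⟩
      0ℚ + (- A i b) * 0ℚ                                         ≡⟨ solve 1 (λ c → con 0ℚ :+ c :* con 0ℚ := con 0ℚ) refl (- A i b) ⟩
      0ℚ                                                          ∎
      where open ≡-Reasoning

    triangular-late-i : ∀ a → Cc D a ps ≗ Cc D a xs ⊕ (- A i a) ⊙ β → Cc D a xs ≗ act D w (α a) →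
                        p ≺ leftmostFree a xs → Cc D i ps ≗ β ⊕ (- A i i) ⊙ β →
                        E (Cc D a ps) (Cc D i ps) ≡ 0ℚ
    triangular-late-i a Ca late p≺a Ci = begin
      E (Cc D a ps) (Cc D i ps)                             ≡⟨ E-cong Ca Ci ⟩
      E (Cc D a xs ⊕ ca ⊙ β) (β ⊕ u ⊙ β)                    ≡⟨ E-expand (Cc D a xs) ca β β u β ⟩
      E (Cc D a xs) β + u * E (Cc D a xs) β + ca * (E β β + u * E β β)
        ≡⟨ cong₂ (λ x y → x + u * x + ca * (y + u * y)) (E-late-β a late (E-β-late a p≺a)) (E-root-self w i) ⟩
      d i * A i a + u * (d i * A i a) + ca * (d i + u * d i)
        ≡⟨ solve 3 (λ δi c u → δi :* c :+ u :* (δi :* c) :+ (:- c) :* (δi :+ u :* δi) := con 0ℚ) refl (d i) (A i a) u ⟩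
      0ℚ                                                    ∎
      where
      open ≡-Reasoning
      ca u : ℚ
      ca = - A i a
      u  = - A i i

    triangular-late-late : ∀ a b → Cc D a ps ≗ Cc D a xs ⊕ (- A i a) ⊙ β → Cc D a xs ≗ act D w (α a) →
                           p ≺ leftmostFree a xs → Cc D b ps ≗ Cc D b xs ⊕ (- A i b) ⊙ β →
                           p ≺ leftmostFree b xs → leftmostFree a xs ≺ leftmostFree b xs →
                           E (Cc D a ps) (Cc D b ps) ≡ 0ℚ
    triangular-late-late a b Ca late p≺a Cb p≺b a≺b = begin
      E (Cc D a ps) (Cc D b ps)                             ≡⟨ E-cong Ca Cb ⟩
      E (Cc D a xs ⊕ ca ⊙ β) (Cc D b xs ⊕ cb ⊙ β)           ≡⟨ E-expand (Cc D a xs) ca β (Cc D b xs) cb β ⟩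
      E (Cc D a xs) (Cc D b xs) + cb * E (Cc D a xs) β + ca * (E β (Cc D b xs) + cb * E β β)
        ≡⟨ cong₂ (λ x y → x + cb * y + ca * (E β (Cc D b xs) + cb * E β β)) (triangular-xs a b a≺b) (E-late-β a late (E-β-late a p≺a)) ⟩
      0ℚ + cb * (d i * A i a) + ca * (E β (Cc D b xs) + cb * E β β)
        ≡⟨ cong₂ (λ x y → 0ℚ + cb * (d i * A i a) + ca * (x + cb * y)) (E-β-late b p≺b) (E-root-self w i) ⟩
      0ℚ + cb * (d i * A i a) + ca * (0ℚ + cb * d i)
        ≡⟨ solve 3 (λ δi c₁ c₂ → con 0ℚ :+ (:- c₂) :* (δi :* c₁) :+ (:- c₁) :* (con 0ℚ :+ (:- c₂) :* δi) := con 0ℚ) refl (d i) (A i a) (A i b) ⟩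
      0ℚ                                                    ∎
      where
      open ≡-Reasoning
      ca cb : ℚ
      ca = - A i a
      cb = - A i b

    triangular-ps : Triangular ps
    triangular-ps a b a≺b with placement a | placement b
    ... | before a≺p ea Ca _ | before b≺p eb Cb _ =
      trans (E-cong Ca Cb) (triangular-xs a b (subst₂ _≺_ (sym ea) (sym eb) a≺b))
    ... | before a≺p ea Ca _ | after p≺b eb Cb _ =
      triangular-early-late a b Ca (subst (_≺ p) (sym ea) a≺p)
        (precedes-late b p≺b eb (subst (_≺ p) (sym ea) a≺p)) Cb
    ... | after p≺a _ _ _ | before b≺p _ _ _ = ⊥-elim (≺-asym (≺-trans p≺a a≺b) b≺p)
    ... | after p≺a ea Ca late | after p≺b eb Cb _ with a Fin.≟ i | b Fin.≟ i
    ...   | yes refl | yes refl = ⊥-elim (≺-irrefl a≺b)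
    ...   | yes refl | no b≢i   =
      ⊥-elim (nothing-after-last xs t a b (Kq b) xs≺p (firstFree-other xs p b (Kq b) b≢i (proj₂ (firstFree-xs b)))
               b≢i (subst₂ _≺_ lf-i-ps (lf-ps b b≢i) a≺b))
    ...   | no a≢i   | yes refl =
      triangular-late-i a Ca late (subst (p ≺_) (sym (ea a≢i)) p≺a)
        (λ k → trans (Cb k) (cong (λ z → z + (- A b b) * β k) (Cc-i-xs k)))
    ...   | no a≢i   | no b≢i   =
      triangular-late-late a b Ca late (subst (p ≺_) (sym (ea a≢i)) p≺a) Cb (subst (p ≺_) (sym (eb b≢i)) p≺b)
        (subst₂ _≺_ (sym (ea a≢i)) (sym (eb b≢i)) a≺b)

    -- The last occurrence of i is now p, so cl_i(ps) = w α_i = β; the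
    -- other cl_r are unchanged.
    cl-i : cl D i ps ≡ β
    cl-i = trans (cl-clFrom D i ps)
                 (cong (clFrom D i) (trans (cong (prefixBeforeLast i) (ListP.map-++ proj₂ xs (p ∷ [])))
                                           (prefixBeforeLast-snoc-same i w)))

    cl-other : ∀ r → r ≢ i → cl D r ps ≡ cl D r xs
    cl-other r r≢i = trans (cl-clFrom D r ps)
      (trans (cong (clFrom D r) (trans (cong (prefixBeforeLast r) (ListP.map-++ proj₂ xs (p ∷ [])))
                                       (prefixBeforeLast-snoc-other r i w (r≢i ∘ sym))))
             (sym (cl-clFrom D r xs)))

    letter-of-xs : ∀ r → r ≢ i → r ∈ letters ps → r ∈ w
    letter-of-xs r r≢i r∈ with ∈-++⁻ w (subst (r ∈_) (ListP.map-++ proj₂ xs (p ∷ [])) r∈)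
    ... | inj₁ r∈w      = r∈w
    ... | inj₂ (here eq) = ⊥-elim (r≢i eq)

    dual-i : ∀ q → E (Cc D q ps) β ≡ target q i
    dual-i q with placement q
    ... | before q≺p eq Cq q≢i = begin
      E (Cc D q ps) β        ≡⟨ E-cong Cq (λ _ → refl) ⟩
      E (Cc D q xs) β        ≡⟨ E-early-β q (subst (_≺ p) (sym eq) q≺p) ⟩
      0ℚ                     ≡⟨ target-off q≢i ⟨
      target q i             ∎
      where open ≡-Reasoning
    ... | after p≺q eq Cq late with q Fin.≟ i
    ...   | yes refl = begin
      E (Cc D q ps) β                      ≡⟨ E-cong (λ k → trans (Cq k) (cong (λ z → z + (- A q q) * β k) (Cc-i-xs k))) (λ _ → refl) ⟩
      E (β ⊕ (- A q q) ⊙ β) β              ≡⟨ E-linˡ β (- A q q) β β ⟩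
      E β β + (- A q q) * E β β            ≡⟨ cong₂ (λ x y → x + (- y) * x) (E-root-self w q) (A-diag q) ⟩
      d q + (- (1ℚ + 1ℚ)) * d q            ≡⟨ solve 1 (λ δq → δq :+ (:- (con 1ℚ :+ con 1ℚ)) :* δq := :- δq) refl (d q) ⟩
      - d q                                ∎
      where open ≡-Reasoning
    ...   | no q≢i = begin
      E (Cc D q ps) β                      ≡⟨ E-cong Cq (λ _ → refl) ⟩
      E (Cc D q xs ⊕ (- A i q) ⊙ β) β      ≡⟨ E-linˡ (Cc D q xs) (- A i q) β β ⟩
      E (Cc D q xs) β + (- A i q) * E β β  ≡⟨ cong₂ (λ x y → x + (- A i q) * y) (E-late-β q late (E-β-late q (subst (p ≺_) (sym (eq q≢i)) p≺q))) (E-root-self w i) ⟩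
      d i * A i q + (- A i q) * d i        ≡⟨ solve 2 (λ δi c → δi :* c :+ (:- c) :* δi := con 0ℚ) refl (d i) (A i q) ⟩
      0ℚ                                   ∎
      where open ≡-Reasoning

    dual-other : ∀ r → r ≢ i → r ∈ w → ∀ q → E (Cc D q ps) (cl D r xs) ≡ target q r
    dual-other r r≢i r∈w q with placement q
    ... | before _ _ Cq _ = trans (E-cong Cq (λ _ → refl)) (dual-xs r r∈w q)
    ... | after _ _ Cq _  = begin
      E (Cc D q ps) (cl D r xs)                                     ≡⟨ E-cong Cq (λ _ → refl) ⟩
      E (Cc D q xs ⊕ (- A i q) ⊙ β) (cl D r xs)                     ≡⟨ E-linˡ (Cc D q xs) (- A i q) β (cl D r xs) ⟩
      E (Cc D q xs) (cl D r xs) + (- A i q) * E β (cl D r xs)       ≡⟨ cong₂ (λ x y → x + (- A i q) * y) (dual-xs r r∈w q) β-dual ⟩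
      target q r + (- A i q) * 0ℚ                                   ≡⟨ solve 2 (λ x c → x :+ c :* con 0ℚ := x) refl (target q r) (- A i q) ⟩
      target q r                                                    ∎
      where
      open ≡-Reasoning
      β-dual : E β (cl D r xs) ≡ 0ℚ
      β-dual = trans (E-cong (λ k → sym (Cc-i-xs k)) (λ _ → refl))
                     (trans (dual-xs r r∈w i) (target-off (r≢i ∘ sym)))

    dual-ps : Dual ps
    dual-ps r r∈ q with r Fin.≟ i
    ... | yes refl = trans (cong (E (Cc D q ps)) cl-i) (dual-i q)
    ... | no r≢i   = trans (cong (E (Cc D q ps)) (cl-other r r≢i)) (dual-other r r≢i (letter-of-xs r r≢i r∈) q)

    firstFree-ps : FirstFreeAll ps
    firstFree-ps q with q Fin.≟ i
    ... | yes refl = suc t , firstFree-after-last xs t q xs≺p sortable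
    ... | no q≢i   = Kq q , firstFree-other xs p q (Kq q) q≢i (proj₂ (firstFree-xs q))

  holds-snoc : ∀ xs x → Holds xs → Holds (xs ++ x ∷ [])
  holds-snoc xs (t , i) holds-xs sorted sortable =
    firstFree-ps , triangular-ps , dual-ps
    where open Extension xs t i sorted sortable holds-xs

  holds : ∀ ps → Holds ps
  holds ps = along (reverseView ps)
    where
    along : ∀ {ps} → Reverse ps → Holds ps
    along []               = holds-[]
    along (xs ∶ rev ∶ʳ x) = holds-snoc xs x (along rev)

module _ {n : ℕ} where

  open import Data.List.Membership.Propositional using (_∈_)
  open import Data.List.Membership.DecPropositional (Fin._≟_ {n}) using (_∈?_)

  occurs-outside-parabolic : ∀ (D : SkewData n) r v (u : Word n) → ¬ InParabolic D r v → EqW D u v → r ∈ u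
  occurs-outside-parabolic D r v u r∉W u≡v with r ∈? u
  ... | yes r∈u = r∈u
  ... | no r∉u  = ⊥-elim (r∉W (u , r∉u , u≡v))

-- R_c^r(v) is characterised by its values on the co-roots (C_c^q)^∨,
-- and ν_c(cl_c^r(v)) takes the right ones by the duality invariant.
proposition5p27 : ∀ {n : ℕ} (D : SkewData n) → SkewSymmetrizable D → Acyclic D → IndexedCompatibly D →
    (v : Word n) (ps : List (Pos n)) → IsCSortingWord D v ps → CSortableWord ps →
    (r : Fin n) → ¬ InParabolic D r v →
    IsRc D r ps (νc D (cl D r ps))
proposition5p27 D skew _ compatible v ps (subword , _ , ps≡v , _) sortable r r∉W q = begin
  pairing D (νc D (cl D r ps)) (Ccᵛ D q ps)     ≡⟨ pairing-νc (cl D r ps) (Ccᵛ D q ps) ⟩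
  - E (Ccᵛ D q ps) (cl D r ps)                  ≡⟨ cong -_ (E-cong (act-coroot (prefixBefore q ps) q) (λ _ → refl)) ⟩
  - E (δ⁻¹ q ⊙ Cc D q ps) (cl D r ps)           ≡⟨ cong -_ (E-scaleˡ (δ⁻¹ q) (Cc D q ps) (cl D r ps)) ⟩
  - (δ⁻¹ q * E (Cc D q ps) (cl D r ps))         ≡⟨ cong (λ z → - (δ⁻¹ q * z)) (dual r r-used q) ⟩
  - (δ⁻¹ q * target q r)                        ≡⟨ target-normalised q r ⟩
  (if q == r then 1ℚ else 0ℚ)                   ∎
  where
  open ≡-Reasoning
  open Geometry D
  open Invariant D skew compatible
  open import Data.Rational using (_*_; -_)
  open import Data.List.Relation.Unary.Linked.Properties using (Linked⇒AllPairs)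
  open import Data.List.Membership.Propositional using (_∈_)
  dual : Dual ps
  dual = proj₂ (proj₂ (holds ps (Linked⇒AllPairs (λ {x} {y} {z} → Positions.<P-trans {_} {x} {y} {z}) subword) sortable))
  r-used : r ∈ letters ps
  r-used = occurs-outside-parabolic D r v (letters ps) r∉W ps≡v
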